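{- Let $n>1$, $\textsf{AP}=\{p\}$, let $K_n$ be a tree structure as described in the context, let $\textsf{Agts}$ be a finite set of agents containing the agent $a$, and let $\varphi_p$ be the KLTL sentence $\forall\textsf{X}\textsf{F}\textsf{K}_a\neg p$. Then for every $p$-blind observation map $\textit{Obs}:\textsf{Agts}\to2^{\{p\}}$, $(K_n,\textit{Obs})\not\models\varphi_p$.
   Context: KCTL$^*$ semantics on an extended Kripke structure $(K,\textit{Obs})$ ($K$ with total transition relation and valuation $V$, $\textit{Obs}:\textsf{Agts}\to2^{\textsf{AP}}$), at initial path $\pi$ and position $i$: atoms, Booleans, $\textsf{X}$, $\textsf{U}$ standard; $\exists\varphi$ holds iff some initial $\pi'$ with $\pi'[0,i]=\pi[0,i]$ satisfies $\varphi$ at $i$; $\forall=\neg\exists\neg$; $\textsf{F}\varphi=\top\textsf{U}\varphi$; $\textsf{K}_a\varphi$ holds iff every initial $\pi'$ with $V(\pi'(j))\cap\textit{Obs}(a)=V(\pi(j))\cap\textit{Obs}(a)$ for all $j\le i$ satisfies $\varphi$ at $i$. $(K,\textit{Obs})\models\varphi$ iff $\pi,0\models\varphi$ for some initial $\pi$. An observation map is $p$-blind if $p\notin\textit{Obs}(b)$ for every agent $b$. Tree structures: nodes form a prefix-closed subset of $\mathbb{N}^*$, root $\varepsilon$ initial, edges only to children; regular = unwinding of a finite Kripke structure. An $n$-block is a word in $\{p\}\emptyset^*$ of length at least $n+2$. $\textit{join}(w_1,\ldots,w_k)$ (for words of common length) is the letterwise union; the dual $\widetilde w$ flips the presence of $p$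 at every position. $\langle w_1,\ldots,w_n\rangle$ (same length) satisfies the $n$-fractal requirement if for all $k\in[1,n]$, $\textit{join}(w_1,\ldots,w_k)=bl^k_1\cdots bl^k_{m_k}\cdot\{p\}$ with $n$-blocks $bl^k_i$, $m_1=n+4$, and for $k<n$, $w_{k+1}$ is obtained from $\textit{join}(w_1,\ldots,w_k)$ by replacing its last symbol with $\emptyset$ and each $n$-block $bl^k_i$ by a sequence of $n+4$ $n$-blocks preceded by a non-empty word in $\emptyset^*$ of length at least $n+2$. $K_n$ is any regular tree structure over $2^{\{p\}}$ such that for some $\ell_n>1$: the root has exactly $n+1$ distinct successors $\eta,\xi_1,\ldots,\xi_n$ with a unique initial path through each (denoted $\pi(\eta),\pi(\xi_k)$); there are words $w_0,\ldots,w_n$ of length $\ell_n$ with trace of $\pi(\eta)$ equal to $\emptyset w_0\{p\}^\omega$, trace of $\pi(\xi_k)$ equal to $\emptyset w_k\emptyset^\omega$, $\langle w_1,\ldots,w_n\rangle$ satisfying the $n$-fractal requirement and $w_0$ the dual of $\textit{join}(w_1,\ldots,w_n)$. -}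

module Defs where

open import Data.Nat using (ℕ; zero; suc; _+_; _≤_; _<_)
open import Data.Bool using (Bool; true; false; _∧_; _∨_; not)
open import Data.Fin using (Fin)
open import Data.List using (List; []; _∷_; _++_; [_]; map; foldr; zipWith; replicate; concat; length; upTo)
open import Data.List.Relation.Unary.All using (All)
open import Data.Product using (Σ; _×_; _,_; ∃; ∃-syntax)
open import Data.Sum using (_⊎_)
open import Data.Empty using (⊥)
open import Data.Unit using (⊤)
open import Relation.Nullary using (¬_)
open import Relation.Binary.PropositionalEquality using (_≡_; _≢_)

-- A subset of AP (a letter of 2^{p}) is a Bool:
-- true = {p}, false = ∅.  Intersection is _∧_, union is _∨_,
-- complement w.r.t. {p} is not.
-- Nodes of tree structures are elements of ℕ* = List ℕ; the children of
-- a node x are the words x ++ [ c ].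

Letter : Set
Letter = Bool

record TreeStructure : Set₁ where
  field
    Node          : List ℕ → Set
    R             : List ℕ → List ℕ → Set
    V             : List ℕ → Letter
    root          : Node []
    prefix-closed : ∀ x c → Node (x ++ [ c ]) → Node x
    R-nodes       : ∀ {x y} → R x y → Node x × Node y
    R-child       : ∀ {x y} → R x y → ∃[ c ] (y ≡ x ++ [ c ])
    total         : ∀ {x} → Node x → ∃[ y ] R x y

open TreeStructure public

Initial : TreeStructure → List ℕ → Set
Initial T x = x ≡ []

record FiniteKripke : Set₁ where
  field
    size   : ℕ
    Rf     : Fin size → Fin size → Set
    Vf     : Fin size → Letter
    init   : Fin size
    totalf : ∀ s → ∃[ t ] Rf s t

open FiniteKripke public

-- T is isomorphic to the unwinding of M from its initial state, witnessed
-- by the labelling f : nodes → states of M: the root is mapped to the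
-- initial state, valuations agree, the edges of T are exactly the edges
-- to children, and for each node x, f restricted to the children of x is
-- a bijection onto the R-successors of f x.
IsUnwindingOf : TreeStructure → FiniteKripke → Set
IsUnwindingOf T M =
  Σ (List ℕ → Fin (size M)) λ f →
      (f [] ≡ init M)
    × (∀ x → Node T x → V T x ≡ Vf M (f x))
    × (∀ x c → Node T (x ++ [ c ]) → R T x (x ++ [ c ]))
    × (∀ x y → R T x y → Rf M (f x) (f y))
    × (∀ x → Node T x → ∀ t → Rf M (f x) t →
         ∃[ c ] (R T x (x ++ [ c ]) × f (x ++ [ c ]) ≡ t))
    × (∀ x c d → R T x (x ++ [ c ]) → R T x (x ++ [ d ]) →
         f (x ++ [ c ]) ≡ f (x ++ [ d ]) → c ≡ d)

Regular : TreeStructure → Set₁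
Regular T = Σ FiniteKripke λ M → IsUnwindingOf T M

record Path (T : TreeStructure) : Set where
  field
    π    : ℕ → List ℕ
    step : ∀ i → R T (π i) (π (suc i))

open Path public

InitialPath : TreeStructure → Set
InitialPath T = Σ (Path T) λ ρ → Initial T (π ρ 0)

path : ∀ {T} → InitialPath T → ℕ → List ℕ
path (ρ , _) = π ρ

data Form (Ag : Set) : Set where
  p    : Form Ag
  tt   : Form Ag
  ¬ᶠ_  : Form Ag → Form Ag
  _∧ᶠ_ : Form Ag → Form Ag → Form Ag
  Xᶠ   : Form Ag → Form Ag
  _Uᶠ_ : Form Ag → Form Ag → Form Ag
  ∃ᶠ   : Form Ag → Form Ag
  Kᶠ   : Ag → Form Ag → Form Ag

∀ᶠ : ∀ {Ag} → Form Ag → Form Ag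
∀ᶠ φ = ¬ᶠ (∃ᶠ (¬ᶠ φ))

Fᶠ : ∀ {Ag} → Form Ag → Form Ag
Fᶠ φ = tt Uᶠ φ

ObsMap : Set → Set
ObsMap Ag = Ag → Letter

PBlind : ∀ {Ag} → ObsMap Ag → Set
PBlind {Ag} Obs = ∀ (b : Ag) → Obs b ≡ false

Sat : ∀ {Ag} (T : TreeStructure) → ObsMap Ag → InitialPath T → ℕ → Form Ag → Set
Sat T Obs ρ i p = V T (path ρ i) ≡ true
Sat T Obs ρ i tt = ⊤
Sat T Obs ρ i (¬ᶠ φ) = ¬ Sat T Obs ρ i φ
Sat T Obs ρ i (φ ∧ᶠ ψ) = Sat T Obs ρ i φ × Sat T Obs ρ i ψ
Sat T Obs ρ i (Xᶠ φ) = Sat T Obs ρ (suc i) φ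
Sat T Obs ρ i (φ Uᶠ ψ) =
  ∃[ k ] (i ≤ k × Sat T Obs ρ k ψ × (∀ j → i ≤ j → j < k → Sat T Obs ρ j φ))
Sat T Obs ρ i (∃ᶠ φ) =
  ∃[ ρ' ] ((∀ j → j ≤ i → path ρ' j ≡ path ρ j) × Sat T Obs ρ' i φ)
Sat T Obs ρ i (Kᶠ a φ) =
  ∀ (ρ' : InitialPath T) →
    (∀ j → j ≤ i → (V T (path ρ' j) ∧ Obs a) ≡ (V T (path ρ j) ∧ Obs a)) →
    Sat T Obs ρ' i φ

Models : ∀ {Ag} (T : TreeStructure) → ObsMap Ag → Form Ag → Set
Models T Obs φ = ∃[ ρ ] Sat T Obs ρ 0 φ

φp : ∀ {Ag} → Ag → Form Ag
φp a = ∀ᶠ (Xᶠ (Fᶠ (Kᶠ a (¬ᶠ p))))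

Word : Set
Word = List Letter

IsBlock : ℕ → Word → Set
IsBlock n w = ∃[ r ] (w ≡ true ∷ replicate r false × n + 2 ≤ suc r)

joinL : ℕ → List Word → Word
joinL ℓ ws = foldr (zipWith _∨_) (replicate ℓ false) ws

joinUpTo : ℕ → (ℕ → Word) → ℕ → Word
joinUpTo ℓ w k = joinL ℓ (map (λ j → w (suc j)) (upTo k))

dual : Word → Word
dual = map not

Replacement : Set
Replacement = ℕ × List Word

ValidReplacement : ℕ → Replacement → Set
ValidReplacement n (r , bs) = (n + 2 ≤ r) × (length bs ≡ n + 4) × All (IsBlock n) bs

expand : Replacement → Word
expand (r , bs) = replicate r false ++ concat bs

-- ⟨w_1,…,w_n⟩ satisfies the n-fractal requirement (words of common
-- length ℓ, w given as an ℕ-indexed family, only indices 1..n matter).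
FractalRequirement : ℕ → ℕ → (ℕ → Word) → Set
FractalRequirement n ℓ w =
  ∀ k → 1 ≤ k → k ≤ n →
    Σ (List Word) λ bls →
        (joinUpTo ℓ w k ≡ concat bls ++ [ true ])
      × All (IsBlock n) bls
      × (k ≡ 1 → length bls ≡ n + 4)
      × (k < n →
          Σ (List Replacement) λ reps →
              (length reps ≡ length bls)
            × All (ValidReplacement n) reps
            × (w (suc k) ≡ concat (map expand reps) ++ [ false ]))

nthD : Word → Letter → ℕ → Letter
nthD [] d _ = d
nthD (x ∷ xs) d zero = x
nthD (x ∷ xs) d (suc j) = nthD xs d j

infTrace : Word → Letter → ℕ → Letter
infTrace w d zero = false
infTrace w d (suc j) = nthD w d j

HasTrace : (T : TreeStructure) → (ℕ → List ℕ) → (ℕ → Letter) → Set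
HasTrace T π t = ∀ i → V T (π i) ≡ t i

UniquePathThrough : (T : TreeStructure) → List ℕ → InitialPath T → Set
UniquePathThrough T x ρ =
  (path ρ 1 ≡ x) ×
  (∀ (ρ' : InitialPath T) → path ρ' 1 ≡ x → ∀ i → path ρ' i ≡ path ρ i)

-- T is a K_n structure (apart from regularity, required separately).
IsKn : ℕ → TreeStructure → Set
IsKn n T =
  Σ ℕ λ ℓ → (1 < ℓ) ×
  Σ (List ℕ) λ η → Σ (ℕ → List ℕ) λ ξ →
  Σ (ℕ → Word) λ w →
  Σ (InitialPath T) λ ρη → Σ (ℕ → InitialPath T) λ ρξ →
      R T [] η
    × (∀ k → 1 ≤ k → k ≤ n → R T [] (ξ k))
    × (∀ y → R T [] y → (y ≡ η) ⊎ (∃[ k ] (1 ≤ k × k ≤ n × y ≡ ξ k)))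
    × (∀ k → 1 ≤ k → k ≤ n → η ≢ ξ k)
    × (∀ k k' → 1 ≤ k → k ≤ n → 1 ≤ k' → k' ≤ n → ξ k ≡ ξ k' → k ≡ k')
    × UniquePathThrough T η ρη
    × (∀ k → 1 ≤ k → k ≤ n → UniquePathThrough T (ξ k) (ρξ k))
    × (∀ k → k ≤ n → length (w k) ≡ ℓ)
    × HasTrace T (path ρη) (infTrace (w 0) true)
    × (∀ k → 1 ≤ k → k ≤ n → HasTrace T (path (ρξ k)) (infTrace (w k) false))
    × FractalRequirement n ℓ w
    × (w 0 ≡ dual (joinUpTo ℓ w n))

module Submission where

-- Since Obs is p-blind, agent a observes nothing, so every
-- initial path is indistinguishable for a from every other one: K_a ¬p holds
-- at position i only if ¬p holds at i on every initial path.  In K_n, however,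
-- every position i ≥ 1 is covered by p on some initial path: either w_0 has p
-- at i - 1 (or i - 1 lies beyond w_0, where the trace of π(η) is {p}^ω), so
-- π(η) carries p at i; or w_0 = dual(join(w_1,…,w_n)) lacks p there, hence
-- the join has p there, hence some w_k does and π(ξ_k) carries p at i.
-- So F K_a ¬p fails at position 1 of π(η), and π(η) (which agrees at position
-- 0 with every initial path) refutes ∀ X F K_a ¬p.

open import Defs
open import Data.Nat using (ℕ; zero; suc; _≤_; _<_; s≤s; z≤n)
open import Data.Fin using (Fin)
open import Data.Bool using (true; false; _∧_; _∨_; not)
open import Data.Bool.Properties using (∧-zeroʳ)
open import Data.List using (List; []; _∷_; map; zipWith; replicate; upTo)
open import Data.List.Membership.Propositional using (_∈_)
open import Data.List.Relation.Unary.Any using (here; there)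
open import Data.List.Membership.Propositional.Properties using (∈-map⁻; ∈-upTo⁻)
open import Data.Product using (_×_; _,_; ∃-syntax; proj₂)
open import Data.Sum using (_⊎_; inj₁; inj₂)
open import Relation.Nullary using (¬_)
open import Relation.Binary.PropositionalEquality using (_≡_; refl; sym; trans; cong)

nthD-dual : ∀ (u : Word) j → nthD (dual u) true j ≡ not (nthD u false j)
nthD-dual []      j       = refl
nthD-dual (x ∷ u) zero    = refl
nthD-dual (x ∷ u) (suc j) = nthD-dual u j

nthD-replicate-false : ∀ ℓ j → nthD (replicate ℓ false) false j ≡ false
nthD-replicate-false zero    j       = refl
nthD-replicate-false (suc ℓ) zero    = refl
nthD-replicate-false (suc ℓ) (suc j) = nthD-replicate-false ℓ j

nthD-∨ : ∀ (u v : Word) j → nthD (zipWith _∨_ u v) false j ≡ true →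
         nthD u false j ≡ true ⊎ nthD v false j ≡ true
nthD-∨ []          v       j       ()
nthD-∨ (x ∷ u)     []      j       ()
nthD-∨ (true ∷ u)  (y ∷ v) zero    _ = inj₁ refl
nthD-∨ (false ∷ u) (y ∷ v) zero    e = inj₂ e
nthD-∨ (x ∷ u)     (y ∷ v) (suc j) e = nthD-∨ u v j e

nthD-join : ∀ ℓ (ws : List Word) j → nthD (joinL ℓ ws) false j ≡ true →
            ∃[ u ] (u ∈ ws × nthD u false j ≡ true)
nthD-join ℓ [] j e with trans (sym e) (nthD-replicate-false ℓ j)
... | ()
nthD-join ℓ (u ∷ ws) j e with nthD-∨ u (joinL ℓ ws) j e
... | inj₁ pu = u , here refl , pu
... | inj₂ pj with nthD-join ℓ ws j pj
...   | v , v∈ws , pv = v , there v∈ws , pv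

dual-join-covers : ∀ ℓ (ws : List Word) j →
                   nthD (dual (joinL ℓ ws)) true j ≡ true
                   ⊎ ∃[ u ] (u ∈ ws × nthD u false j ≡ true)
dual-join-covers ℓ ws j with nthD (joinL ℓ ws) false j in eq
... | true  = inj₂ (nthD-join ℓ ws j eq)
... | false = inj₁ (trans (nthD-dual (joinL ℓ ws) j) (cong not eq))

PositivelyCovered : TreeStructure → Set
PositivelyCovered T = ∀ j → ∃[ ρ ] (V T (path {T} ρ (suc j)) ≡ true)

-- In K_n the paths π(η), π(ξ_1), …, π(ξ_n) cover every position i ≥ 1
-- with p, because w_0 is the dual of join(w_1, …, w_n).
Kn-positively-covered : ∀ n T → IsKn n T → PositivelyCovered T
Kn-positively-covered n T
  (ℓ , _ , η , ξ , w , ρη , ρξ , _ , _ , _ , _ , _ , _ , _ , _ , trη , trξ , _ , w0≡dual) j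
  with dual-join-covers ℓ (map (λ k → w (suc k)) (upTo n)) j
... | inj₁ pη = ρη , trans (trη (suc j)) (trans (cong (λ u → nthD u true j) w0≡dual) pη)
... | inj₂ (u , u∈ws , pu) with ∈-map⁻ (λ k → w (suc k)) u∈ws
...   | k , k∈upTo , refl =
  ρξ (suc k) , trans (trξ (suc k) (s≤s z≤n) (∈-upTo⁻ k∈upTo) (suc j)) pu

blind-indistinguishable : ∀ {Ag} (T : TreeStructure) (Obs : ObsMap Ag) a →
  Obs a ≡ false → ∀ (ρ ρ' : InitialPath T) j →
  (V T (path ρ' j) ∧ Obs a) ≡ (V T (path ρ j) ∧ Obs a)
blind-indistinguishable T Obs a blind ρ ρ' j rewrite blind =
  trans (∧-zeroʳ _) (sym (∧-zeroʳ _))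

blind-cannot-know-¬p : ∀ {Ag} (T : TreeStructure) (Obs : ObsMap Ag) a →
  Obs a ≡ false → ∀ (ρ : InitialPath T) i →
  ∃[ ρ' ] (V T (path ρ' i) ≡ true) → ¬ Sat T Obs ρ i (Kᶠ a (¬ᶠ p))
blind-cannot-know-¬p T Obs a blind ρ i (ρ' , pρ') knows =
  knows ρ' (λ j _ → blind-indistinguishable T Obs a blind ρ ρ' j) pρ'

never-knows-¬p : ∀ {Ag} (T : TreeStructure) (Obs : ObsMap Ag) a →
  Obs a ≡ false → PositivelyCovered T →
  ∀ (ρ : InitialPath T) → ¬ Sat T Obs ρ 1 (Fᶠ (Kᶠ a (¬ᶠ p)))
never-knows-¬p T Obs a blind covered ρ (zero  , ()  , _)
never-knows-¬p T Obs a blind covered ρ (suc j , _   , knows , _) =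
  blind-cannot-know-¬p T Obs a blind ρ (suc j) (covered j) knows

initial-agree : ∀ (T : TreeStructure) (ρ ρ' : InitialPath T) j → j ≤ 0 →
                path ρ' j ≡ path ρ j
initial-agree T ρ ρ' zero _ = trans (proj₂ ρ') (sym (proj₂ ρ))

proposition3 : (n : ℕ) → 1 < n → (T : TreeStructure) → Regular T → IsKn n T →
               (m : ℕ) (a : Fin m) (Obs : ObsMap (Fin m)) → PBlind Obs →
               ¬ Models T Obs (φp a)
proposition3 n _ T _ kn m a Obs blind (ρ , allXFK) =
  allXFK (ρη , initial-agree T ρ ρη ,
          never-knows-¬p T Obs a (blind a) (Kn-positively-covered n T kn) ρη)
  where
    ρη : InitialPath T
    ρη = let (_ , _ , _ , _ , _ , ρη , _) = kn in ρη
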